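{- Let $L$ be a frame, let $X$ be its Priestley space with Stone map $\sigma$, and let $Y\subseteq X$ be the set of completely prime filters of $L$. Then: (1) an element $a\in L$ is compact if and only if $\sigma(a)$ is an S-upset of $X$; (2) $L$ is compact (i.e. its top element $1$ is compact) if and only if $\min X\subseteq Y$.
   Context: A frame is a complete lattice $L$ with $a\wedge\bigvee S=\bigvee\{a\wedge s: s\in S\}$. The Priestley space $X$ of $L$ is the set of prime filters of $L$ ordered by inclusion, with the topology generated by the subbasis $\{\sigma(a): a\in L\}\cup\{X\setminus\sigma(b): b\in L\}$, where $\sigma(a)=\{x\in X: a\in x\}$. A filter $F$ of $L$ is completely prime if $\bigvee S\in F$ implies $S\cap F\neq\varnothing$; the set $Y$ of completely prime filters is regarded as a subset of $X$. An element $a\in L$ is compact if $a\le\bigvee S$ implies $a\le\bigvee T$ for some finite $T\subseteq S$. For $K\subseteq X$, $\min K$ is the set of minimal elements of $K$. An S-upset (Scott-upset) of $X$ is a closed upset $K$ of $X$ with $\min K\subseteq Y$. -}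

module Defs where

open import Level using (Level; _⊔_; suc; Setω)
open import Data.Product using (Σ; ∃; _×_; _,_; proj₁; proj₂)
open import Data.Sum using (_⊎_; inj₁; inj₂)
open import Data.Empty.Polymorphic using (⊥)
open import Data.Unit.Polymorphic using (⊤)
open import Data.List using (List)
open import Data.List.Relation.Unary.All using (All)
open import Data.List.Membership.Propositional using (_∈_)
open import Relation.Nullary using (¬_; Dec)
open import Relation.Binary.PropositionalEquality using (_≡_)
open import Relation.Binary.Structures using (IsPartialOrder)

record Frame (c : Level) : Set (suc c) where
  infix 4 _≤_
  infixr 7 _∧_
  field
    Carrier        : Set c
    _≤_            : Carrier → Carrier → Set c
    isPartialOrder : IsPartialOrder _≡_ _≤_
    ⋁              : (Carrier → Set c) → Carrier
    ⋁-upper        : ∀ (S : Carrier → Set c) x → S x → x ≤ ⋁ S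
    ⋁-least        : ∀ (S : Carrier → Set c) u → (∀ x → S x → x ≤ u) → ⋁ S ≤ u
    _∧_            : Carrier → Carrier → Carrier
    ∧-lowerˡ       : ∀ a b → a ∧ b ≤ a
    ∧-lowerʳ       : ∀ a b → a ∧ b ≤ b
    ∧-greatest     : ∀ a b x → x ≤ a → x ≤ b → x ≤ a ∧ b
    distrib        : ∀ a (S : Carrier → Set c) →
                     a ∧ ⋁ S ≡ ⋁ (λ y → Σ Carrier λ s → S s × (y ≡ a ∧ s))

  ⊤L : Carrier
  ⊤L = ⋁ (λ _ → ⊤)

  ⊥L : Carrier
  ⊥L = ⋁ (λ _ → ⊥)

  _∨_ : Carrier → Carrier → Carrier
  a ∨ b = ⋁ (λ x → (x ≡ a) ⊎ (x ≡ b))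

module _ {c : Level} (L : Frame c) where
  open Frame L

  record IsFilter (F : Carrier → Set c) : Set c where
    field
      up     : ∀ a b → a ≤ b → F a → F b
      hasTop : F ⊤L
      meet   : ∀ a b → F a → F b → F (a ∧ b)

  record IsPrimeFilter (F : Carrier → Set c) : Set c where
    field
      isFilter : IsFilter F
      proper   : ¬ F ⊥L
      prime    : ∀ a b → F (a ∨ b) → F a ⊎ F b

  IsCompletelyPrime : (Carrier → Set c) → Set (suc c)
  IsCompletelyPrime F = ∀ (S : Carrier → Set c) → F (⋁ S) → Σ Carrier λ s → S s × F s

  IsCompact : Carrier → Set (suc c)
  IsCompact a = ∀ (S : Carrier → Set c) → a ≤ ⋁ S →
    Σ (List Carrier) λ ts → All S ts × (a ≤ ⋁ (λ x → x ∈ ts))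

  IsCompactFrame : Set (suc c)
  IsCompactFrame = IsCompact ⊤L

  PriestleyPt : Set (suc c)
  PriestleyPt = Σ (Carrier → Set c) IsPrimeFilter

  filt : PriestleyPt → Carrier → Set c
  filt = proj₁

  _⊑_ : PriestleyPt → PriestleyPt → Set c
  x ⊑ y = ∀ a → filt x a → filt y a

  σ : Carrier → PriestleyPt → Set c
  σ a x = filt x a

  Y : PriestleyPt → Set (suc c)
  Y x = IsCompletelyPrime (filt x)

  -- Topology generated by the subbasis {σ a} ∪ {X ∖ σ b}:
  -- a basic open set is a finite intersection of subbasic sets, coded by
  -- a list; inj₁ a stands for σ(a), inj₂ b for X ∖ σ(b).
  Subbasic : Carrier ⊎ Carrier → PriestleyPt → Set c
  Subbasic (inj₁ a) x = σ a x
  Subbasic (inj₂ b) x = ¬ σ b x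

  Basic : List (Carrier ⊎ Carrier) → PriestleyPt → Set c
  Basic l x = All (λ s → Subbasic s x) l

  IsOpen : (PriestleyPt → Set c) → Set (suc c)
  IsOpen U = ∀ x → U x →
    Σ (List (Carrier ⊎ Carrier)) λ l → Basic l x × (∀ y → Basic l y → U y)

  IsClosed : (PriestleyPt → Set c) → Set (suc c)
  IsClosed K = IsOpen (λ x → ¬ K x)

  IsUpset : (PriestleyPt → Set c) → Set (suc c)
  IsUpset K = ∀ x y → x ⊑ y → K x → K y

  Min : (PriestleyPt → Set c) → PriestleyPt → Set (suc c)
  Min K x = K x × (∀ y → K y → y ⊑ x → x ⊑ y)

  IsSUpset : (PriestleyPt → Set c) → Set (suc c)
  IsSUpset K = IsClosed K × IsUpset K × (∀ x → Min K x → Y x)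

-- Classical ambient axioms (the paper works in ZFC).

LEM : Setω
LEM = ∀ {ℓ} (P : Set ℓ) → Dec P

Zorn : Setω
Zorn = ∀ {a r k} (A : Set a) (_≼_ : A → A → Set r) →
  (∀ x → x ≼ x) → (∀ x y z → x ≼ y → y ≼ z → x ≼ z) →
  (∀ (C : A → Set k) → (∀ x y → C x → C y → (x ≼ y) ⊎ (y ≼ x)) →
     Σ A λ u → ∀ x → C x → x ≼ u) →
  Σ A λ m → ∀ y → m ≼ y → y ≼ m

-- Two separation arguments do the work. By the prime filter theorem, an element a lying
-- outside an ideal J is contained in a prime filter disjoint from J; by Zorn's lemma,
-- every x ∈ σ(a) lies above a minimal point of σ(a), since the intersection of a chain
-- of prime filters is prime.
-- If a is compact, x is minimal in σ(a) and ⋁S ∈ x, then a ≤ ⋁S ∨ e for some e ∉ x: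
-- otherwise a prime filter containing a and avoiding the ideal generated by ⋁S and L ∖ x
-- would lie below x without containing ⋁S. A finite subcover of S ∪ {e} then puts some
-- s ∈ S into x, so x is completely prime.
-- If a is not compact for a cover S, a prime filter containing a and avoiding all finite
-- joins from S lies above a minimal point m of σ(a); then ⋁S ∈ m, but no s ∈ S is, so m
-- is not completely prime. Part (2) is part (1) for a = 1, as σ(1) = X.
module Submission where

open import Defs hiding (_⊑_)
import Defs
open import Level using (Level; Lift; lift) renaming (suc to lsuc)
open import Data.Product using (Σ; ∃; _×_; _,_; proj₁; proj₂)
open import Data.Sum using (_⊎_; inj₁; inj₂; [_,_])
import Data.Sum as Sum
open import Data.Unit.Polymorphic using (⊤; tt)
open import Data.Empty using (⊥; ⊥-elim)
open import Data.Maybe using (Maybe; nothing; just)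
open import Data.List using (List; []; _∷_; _++_)
open import Data.List.Relation.Unary.All using (All; []; _∷_)
import Data.List.Relation.Unary.All as All
open import Data.List.Relation.Unary.All.Properties using (++⁺)
open import Data.List.Relation.Unary.Any using (here; there)
open import Data.List.Membership.Propositional using (_∈_)
open import Data.List.Membership.Propositional.Properties using (∈-++⁺ˡ; ∈-++⁺ʳ)
open import Relation.Nullary using (¬_; yes; no)
open import Relation.Nullary.Decidable using (True; toWitness; fromWitness; decidable-stable)
open import Relation.Unary using (_⊆_)
open import Relation.Binary.PropositionalEquality using (_≡_; refl; sym; subst)
open import Relation.Binary.Structures using (IsPartialOrder)
open import Function using (_∘_)
open import Function.Bundles using (_⇔_; mk⇔; Equivalence)
open import Function.Properties.Equivalence using () renaming (sym to ⇔-sym)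

module Classical (lem : LEM) where

  stable : ∀ {ℓ} {P : Set ℓ} → ¬ ¬ P → P
  stable = decidable-stable (lem _)

  ¬∀⇒∃¬ : ∀ {a b} {I : Set a} {P : I → Set b} → ¬ (∀ i → P i) → ∃ λ i → ¬ P i
  ¬∀⇒∃¬ ¬∀ = stable λ ¬∃ → ¬∀ λ i → stable λ ¬Pi → ¬∃ (i , ¬Pi)

  -- Unions and intersections of chains of filters quantify over a larger universe than
  -- the filters themselves live in; excluded middle brings such propositions back down.
  Resized : ∀ {ℓ} (c : Level) → Set ℓ → Set c
  Resized c P = Lift c (True (lem P))

  resize : ∀ {ℓ c} {P : Set ℓ} → P → Resized c P
  resize p = lift (fromWitness p)

  unresize : ∀ {ℓ c} {P : Set ℓ} → Resized c P → P
  unresize (lift p) = toWitness p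

module _ {c : Level} (L : Frame c) where
  open Frame L

  ≤-refl : ∀ {x} → x ≤ x
  ≤-refl = IsPartialOrder.refl isPartialOrder

  ≤-trans : ∀ {x y z} → x ≤ y → y ≤ z → x ≤ z
  ≤-trans = IsPartialOrder.trans isPartialOrder

  ⋁-mono : ∀ {S T : Carrier → Set c} → (∀ x → S x → T x) → ⋁ S ≤ ⋁ T
  ⋁-mono S⊆T = ⋁-least _ _ λ x Sx → ⋁-upper _ x (S⊆T x Sx)

  x≤⊤L : ∀ x → x ≤ ⊤L
  x≤⊤L x = ⋁-upper _ x tt

  ⊥L≤x : ∀ x → ⊥L ≤ x
  ⊥L≤x x = ⋁-least _ x λ _ ()

  x≤x∨y : ∀ {x y} → x ≤ x ∨ y
  x≤x∨y {x} = ⋁-upper _ x (inj₁ refl)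

  y≤x∨y : ∀ {x y} → y ≤ x ∨ y
  y≤x∨y {y = y} = ⋁-upper _ y (inj₂ refl)

  ∨-least : ∀ {x y z} → x ≤ z → y ≤ z → x ∨ y ≤ z
  ∨-least x≤z y≤z = ⋁-least _ _ λ { _ (inj₁ refl) → x≤z ; _ (inj₂ refl) → y≤z }

  ∨-monoʳ : ∀ {x y z} → y ≤ z → x ∨ y ≤ x ∨ z
  ∨-monoʳ y≤z = ∨-least x≤x∨y (≤-trans y≤z y≤x∨y)

  ∧-monoˡ : ∀ {x y} z → x ≤ y → x ∧ z ≤ y ∧ z
  ∧-monoˡ z x≤y = ∧-greatest _ _ _ (≤-trans (∧-lowerˡ _ _) x≤y) (∧-lowerʳ _ _)

  ∧-distribˡ-∨ : ∀ x y z → x ∧ (y ∨ z) ≤ (x ∧ y) ∨ (x ∧ z)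
  ∧-distribˡ-∨ x y z = subst (_≤ (x ∧ y) ∨ (x ∧ z)) (sym (distrib x _))
    (⋁-least _ _ λ { _ (_ , inj₁ refl , refl) → x≤x∨y ; _ (_ , inj₂ refl , refl) → y≤x∨y })

  ↑-isFilter : ∀ a → IsFilter L (a ≤_)
  ↑-isFilter a = record
    { up = λ _ _ b≤d a≤b → ≤-trans a≤b b≤d
    ; hasTop = x≤⊤L a
    ; meet = λ b d → ∧-greatest b d a
    }

  adjoin : (Carrier → Set c) → Carrier → Carrier → Set c
  adjoin F b d = Σ Carrier λ m → F m × m ∧ b ≤ d

  adjoin-isFilter : ∀ {F} b → IsFilter L F → IsFilter L (adjoin F b)
  adjoin-isFilter b F-filter = record
    { up = λ _ _ d≤e (m , Fm , m∧b≤d) → m , Fm , ≤-trans m∧b≤d d≤e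
    ; hasTop = ⊤L , hasTop , x≤⊤L _
    ; meet = λ d e (m , Fm , m∧b≤d) (n , Fn , n∧b≤e) →
        m ∧ n , meet m n Fm Fn ,
        ∧-greatest d e _ (≤-trans (∧-monoˡ b (∧-lowerˡ m n)) m∧b≤d)
                         (≤-trans (∧-monoˡ b (∧-lowerʳ m n)) n∧b≤e)
    }
    where open IsFilter F-filter

  record IsIdeal (J : Carrier → Set c) : Set c where
    field
      ⊥L∈      : J ⊥L
      down     : ∀ {d e} → d ≤ e → J e → J d
      ∨-closed : ∀ {d e} → J d → J e → J (d ∨ e)

  BelowFiniteJoin : (Carrier → Set c) → Carrier → Set c
  BelowFiniteJoin S d = Σ (List Carrier) λ ts → All S ts × d ≤ ⋁ (_∈ ts)

  BelowFiniteJoin-isIdeal : ∀ S → IsIdeal (BelowFiniteJoin S)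
  BelowFiniteJoin-isIdeal S = record
    { ⊥L∈ = [] , [] , ⊥L≤x _
    ; down = λ d≤e (ts , ts⊆S , e≤⋁ts) → ts , ts⊆S , ≤-trans d≤e e≤⋁ts
    ; ∨-closed = λ (ts , ts⊆S , d≤⋁ts) (us , us⊆S , e≤⋁us) →
        ts ++ us , ++⁺ ts⊆S us⊆S ,
        ∨-least (≤-trans d≤⋁ts (⋁-mono λ _ → ∈-++⁺ˡ))
                (≤-trans e≤⋁us (⋁-mono λ _ → ∈-++⁺ʳ ts))
    }

  X : Set (lsuc c)
  X = PriestleyPt L

  _∈ₚ_ : Carrier → X → Set c
  a ∈ₚ x = proj₁ x a

  _⊑_ : X → X → Set c
  _⊑_ = Defs._⊑_ L

  module _ (x : X) where
    open IsPrimeFilter (proj₂ x)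
    open IsFilter isFilter

    ∈ₚ-up : ∀ {a b} → a ≤ b → a ∈ₚ x → b ∈ₚ x
    ∈ₚ-up = up _ _

    ⊤L∈ₚ : ⊤L ∈ₚ x
    ⊤L∈ₚ = hasTop

    ∧-∈ₚ : ∀ {a b} → a ∈ₚ x → b ∈ₚ x → (a ∧ b) ∈ₚ x
    ∧-∈ₚ = meet _ _

    ⊥L∉ₚ : ¬ ⊥L ∈ₚ x
    ⊥L∉ₚ = proper

    ∨-∈ₚ : ∀ {a b} → (a ∨ b) ∈ₚ x → a ∈ₚ x ⊎ b ∈ₚ x
    ∨-∈ₚ = prime _ _

  ⋁-list-∈ₚ : ∀ x ts → ⋁ (_∈ ts) ∈ₚ x → ∃ λ t → t ∈ ts × t ∈ₚ x
  ⋁-list-∈ₚ x [] ⋁[]∈x = ⊥-elim (⊥L∉ₚ x (∈ₚ-up x (⋁-least _ ⊥L λ _ ()) ⋁[]∈x))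
  ⋁-list-∈ₚ x (t ∷ ts) ⋁t∷ts∈x with ∨-∈ₚ x (∈ₚ-up x ⋁t∷ts≤t∨⋁ts ⋁t∷ts∈x)
    where
    ⋁t∷ts≤t∨⋁ts : ⋁ (_∈ t ∷ ts) ≤ t ∨ ⋁ (_∈ ts)
    ⋁t∷ts≤t∨⋁ts = ⋁-least _ _ λ
      { _ (here refl) → x≤x∨y
      ; u (there u∈ts) → ≤-trans (⋁-upper _ u u∈ts) y≤x∨y }
  ... | inj₁ t∈x = t , here refl , t∈x
  ... | inj₂ ⋁ts∈x with ⋁-list-∈ₚ x ts ⋁ts∈x
  ...   | u , u∈ts , u∈x = u , there u∈ts , u∈x

  JoinWithOutside : X → Carrier → Carrier → Set c
  JoinWithOutside x b d = Σ Carrier λ e → ¬ e ∈ₚ x × d ≤ b ∨ e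

  JoinWithOutside-isIdeal : ∀ x b → IsIdeal (JoinWithOutside x b)
  JoinWithOutside-isIdeal x b = record
    { ⊥L∈ = ⊥L , ⊥L∉ₚ x , ⊥L≤x _
    ; down = λ d≤e (f , f∉x , e≤b∨f) → f , f∉x , ≤-trans d≤e e≤b∨f
    ; ∨-closed = λ (e , e∉x , d≤b∨e) (f , f∉x , d'≤b∨f) →
        e ∨ f , [ e∉x , f∉x ] ∘ ∨-∈ₚ x ,
        ∨-least (≤-trans d≤b∨e (∨-monoʳ x≤x∨y)) (≤-trans d'≤b∨f (∨-monoʳ y≤x∨y))
    }

  σ-isClosed : ∀ a → IsClosed L (σ L a)
  σ-isClosed a x a∉x = inj₂ a ∷ [] , a∉x ∷ [] , λ { y (a∉y ∷ []) → a∉y }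

  σ-isUpset : ∀ a → IsUpset L (σ L a)
  σ-isUpset a x y x⊑y a∈x = x⊑y a a∈x

  Min-cong : ∀ {K K′ : X → Set c} → (∀ x → K x ⇔ K′ x) → ∀ x → Min L K x → Min L K′ x
  Min-cong K⇔K′ x (Kx , minimal) =
    Equivalence.to (K⇔K′ x) Kx , λ y K′y y⊑x → minimal y (Equivalence.from (K⇔K′ y) K′y) y⊑x

  module _ (lem : LEM) where
    open Classical lem

    ⋃ : ∀ {ℓ} {I : Set ℓ} → (I → Carrier → Set c) → Carrier → Set c
    ⋃ F d = Resized c (∃ λ i → F i d)

    ⋃-isFilter : ∀ {ℓ} {I : Set ℓ} (F : I → Carrier → Set c) → (∀ i → IsFilter L (F i)) →
                 I → (∀ i j → F i ⊆ F j ⊎ F j ⊆ F i) → IsFilter L (⋃ F)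
    ⋃-isFilter F F-filter i₀ comparable = record
      { up = λ d e d≤e d∈ → resize (up-in d≤e (unresize d∈))
      ; hasTop = resize (i₀ , IsFilter.hasTop (F-filter i₀))
      ; meet = λ d e d∈ e∈ → resize (meet-in (unresize d∈) (unresize e∈))
      }
      where
      up-in : ∀ {d e} → d ≤ e → ∃ (λ i → F i d) → ∃ (λ i → F i e)
      up-in d≤e (i , d∈Fi) = i , IsFilter.up (F-filter i) _ _ d≤e d∈Fi
      meet-in : ∀ {d e} → ∃ (λ i → F i d) → ∃ (λ i → F i e) → ∃ (λ i → F i (d ∧ e))
      meet-in (i , d∈Fi) (j , e∈Fj) with comparable i j
      ... | inj₁ Fi⊆Fj = j , IsFilter.meet (F-filter j) _ _ (Fi⊆Fj d∈Fi) e∈Fj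
      ... | inj₂ Fj⊆Fi = i , IsFilter.meet (F-filter i) _ _ d∈Fi (Fj⊆Fi e∈Fj)

    ⋂ : ∀ {ℓ} {I : Set ℓ} → (I → X) → Carrier → Set c
    ⋂ f d = Resized c (∀ i → d ∈ₚ f i)

    ⋂-isPrimeFilter : ∀ {ℓ} {I : Set ℓ} (f : I → X) →
                      I → (∀ i j → f i ⊑ f j ⊎ f j ⊑ f i) → IsPrimeFilter L (⋂ f)
    ⋂-isPrimeFilter f i₀ comparable = record
      { isFilter = record
        { up = λ d e d≤e d∈ → resize λ i → ∈ₚ-up (f i) d≤e (unresize d∈ i)
        ; hasTop = resize λ i → ⊤L∈ₚ (f i)
        ; meet = λ d e d∈ e∈ → resize λ i → ∧-∈ₚ (f i) (unresize d∈ i) (unresize e∈ i)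
        }
      ; proper = λ ⊥L∈ → ⊥L∉ₚ (f i₀) (unresize ⊥L∈ i₀)
      ; prime = λ b d b∨d∈ → Sum.map resize resize (prime (unresize b∨d∈))
      }
      where
      outside-both : ∀ {b d} → (∀ i → (b ∨ d) ∈ₚ f i) →
                     ∃ (λ i → ¬ b ∈ₚ f i) → ∃ (λ j → ¬ d ∈ₚ f j) → ⊥
      outside-both b∨d∈ (i , b∉fi) (j , d∉fj) with comparable i j
      ... | inj₁ fi⊑fj = [ b∉fi , (λ d∈fi → d∉fj (fi⊑fj _ d∈fi)) ] (∨-∈ₚ (f i) (b∨d∈ i))
      ... | inj₂ fj⊑fi = [ (λ b∈fj → b∉fi (fj⊑fi _ b∈fj)) , d∉fj ] (∨-∈ₚ (f j) (b∨d∈ j))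

      prime : ∀ {b d} → (∀ i → (b ∨ d) ∈ₚ f i) → (∀ i → b ∈ₚ f i) ⊎ (∀ i → d ∈ₚ f i)
      prime {b} {d} b∨d∈ with lem (∀ i → b ∈ₚ f i) | lem (∀ i → d ∈ₚ f i)
      ... | yes b∈ | _ = inj₁ b∈
      ... | no _ | yes d∈ = inj₂ d∈
      ... | no b∉ | no d∉ = ⊥-elim (outside-both b∨d∈ (¬∀⇒∃¬ b∉) (¬∀⇒∃¬ d∉))

    module _ (zorn : Zorn) where

      module PrimeFilterTheorem {J : Carrier → Set c} {a : Carrier}
                                (J-ideal : IsIdeal J) (a∉J : ¬ J a) where
        open IsIdeal J-ideal

        record Candidate : Set (lsuc c) where
          field
            pred     : Carrier → Set c
            isFilter : IsFilter L pred
            ∋a       : pred a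
            disjoint : ∀ d → pred d → ¬ J d

        _≼_ : Candidate → Candidate → Set c
        F ≼ G = Candidate.pred F ⊆ Candidate.pred G

        principal : Candidate
        principal = record
          { pred = a ≤_
          ; isFilter = ↑-isFilter a
          ; ∋a = ≤-refl
          ; disjoint = λ d a≤d J-d → a∉J (down a≤d J-d)
          }

        principal-least : ∀ F → principal ≼ F
        principal-least F a≤d = IsFilter.up isFilter _ _ a≤d ∋a
          where open Candidate F

        -- The principal filter is added to the chain so that the empty chain has a bound.
        chain-bound : (C : Candidate → Set c) → (∀ F G → C F → C G → F ≼ G ⊎ G ≼ F) →
                      Σ Candidate λ U → ∀ F → C F → F ≼ U
        chain-bound C chain =
          record
            { pred = ⋃ (Candidate.pred ∘ member)
            ; isFilter = ⋃-isFilter _ (Candidate.isFilter ∘ member) nothing comparable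
            ; ∋a = resize (nothing , ≤-refl)
            ; disjoint = λ d d∈ → let (i , d∈i) = unresize d∈ in Candidate.disjoint (member i) d d∈i
            } ,
          λ F CF d∈F → resize (just (F , CF) , d∈F)
          where
          member : Maybe (Σ Candidate C) → Candidate
          member nothing = principal
          member (just (F , _)) = F
          comparable : ∀ i j → member i ≼ member j ⊎ member j ≼ member i
          comparable nothing j = inj₁ (principal-least (member j))
          comparable i nothing = inj₂ (principal-least (member i))
          comparable (just (F , CF)) (just (G , CG)) = chain F G CF CG

        maximal : Σ Candidate λ M → ∀ G → M ≼ G → G ≼ M
        maximal = zorn Candidate _≼_ (λ _ d∈ → d∈) (λ _ _ _ F≼G G≼H → G≼H ∘ F≼G) chain-bound

        open Candidate (proj₁ maximal) renaming (pred to M)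
        open IsFilter isFilter

        escape : ∀ {b} → ¬ M b → Σ Carrier λ m → M m × J (m ∧ b)
        escape {b} b∉M = stable λ no-escape →
          b∉M (proj₂ maximal (extension no-escape) (λ {d} Md → d , Md , ∧-lowerˡ d b) (⊤L , hasTop , ∧-lowerʳ ⊤L b))
          where
          extension : ¬ (Σ Carrier λ m → M m × J (m ∧ b)) → Candidate
          extension no-escape = record
            { pred = adjoin M b
            ; isFilter = adjoin-isFilter b isFilter
            ; ∋a = a , ∋a , ∧-lowerˡ a b
            ; disjoint = λ d (m , Mm , m∧b≤d) J-d → no-escape (m , Mm , down m∧b≤d J-d)
            }

        M-prime : ∀ b d → M (b ∨ d) → M b ⊎ M d
        M-prime b d b∨d∈M with lem (M b) | lem (M d)
        ... | yes b∈M | _ = inj₁ b∈M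
        ... | no _ | yes d∈M = inj₂ d∈M
        ... | no b∉M | no d∉M with escape b∉M | escape d∉M
        ...   | m , Mm , J-m∧b | n , Mn , J-n∧d =
          ⊥-elim (disjoint _ (meet _ _ (meet m n Mm Mn) b∨d∈M)
            (down (∧-distribˡ-∨ (m ∧ n) b d)
              (∨-closed (down (∧-monoˡ b (∧-lowerˡ m n)) J-m∧b)
                        (down (∧-monoˡ d (∧-lowerʳ m n)) J-n∧d))))

        separating-point : Σ X λ z → a ∈ₚ z × (∀ d → d ∈ₚ z → ¬ J d)
        separating-point =
          (M , record { isFilter = isFilter ; proper = λ ⊥L∈M → disjoint _ ⊥L∈M ⊥L∈ ; prime = M-prime }) ,
          ∋a , disjoint

      prime-filter-theorem : ∀ {J a} → IsIdeal J → ¬ J a → Σ X λ z → a ∈ₚ z × (∀ d → d ∈ₚ z → ¬ J d)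
      prime-filter-theorem = PrimeFilterTheorem.separating-point

      module MinimalBelow {a : Carrier} (x : X) (a∈x : a ∈ₚ x) where

        record Below : Set (lsuc c) where
          constructor below
          field
            point : X
            ∋a    : a ∈ₚ point
            ⊑x    : point ⊑ x

        _≽_ : Below → Below → Set c
        y ≽ z = Below.point z ⊑ Below.point y

        -- x is added to the chain so that the empty chain has a bound.
        chain-bound : (C : Below → Set c) → (∀ y z → C y → C z → y ≽ z ⊎ z ≽ y) →
                      Σ Below λ l → ∀ y → C y → y ≽ l
        chain-bound C chain =
          below (⋂ point , ⋂-isPrimeFilter point nothing comparable)
                (resize point-∋a) (λ d d∈ → unresize d∈ nothing) ,
          λ y Cy d d∈ → unresize d∈ (just (y , Cy))
          where
          point : Maybe (Σ Below C) → X
          point nothing = x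
          point (just (y , _)) = Below.point y
          point-∋a : ∀ i → a ∈ₚ point i
          point-∋a nothing = a∈x
          point-∋a (just (y , _)) = Below.∋a y
          comparable : ∀ i j → point i ⊑ point j ⊎ point j ⊑ point i
          comparable nothing nothing = inj₁ λ _ d∈ → d∈
          comparable nothing (just (z , _)) = inj₂ (Below.⊑x z)
          comparable (just (y , _)) nothing = inj₁ (Below.⊑x y)
          comparable (just (y , Cy)) (just (z , Cz)) = chain z y Cz Cy

        maximal : Σ Below λ m → ∀ y → m ≽ y → y ≽ m
        maximal = zorn Below _≽_ (λ _ _ d∈ → d∈) (λ _ _ _ y≽z z≽w d → y≽z d ∘ z≽w d) chain-bound

        minimal-point : Σ X λ m → m ⊑ x × Min L (σ L a) m
        minimal-point = point , ⊑x , ∋a ,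
          λ y a∈y y⊑m → proj₂ maximal (below y a∈y λ d → ⊑x d ∘ y⊑m d) y⊑m
          where open Below (proj₁ maximal)

      minimal-below : ∀ {a} x → a ∈ₚ x → Σ X λ m → m ⊑ x × Min L (σ L a) m
      minimal-below = MinimalBelow.minimal-point

      min-σ-cover : ∀ {a b} x → Min L (σ L a) x → b ∈ₚ x → Σ Carrier λ e → ¬ e ∈ₚ x × a ≤ b ∨ e
      min-σ-cover {b = b} x (a∈x , minimal) b∈x = stable λ a∉J →
        let (z , a∈z , z∩J≡∅) = prime-filter-theorem (JoinWithOutside-isIdeal x b) a∉J
            z⊑x : z ⊑ x
            z⊑x d d∈z = stable λ d∉x → z∩J≡∅ d d∈z (d , d∉x , y≤x∨y)
        in z∩J≡∅ b (minimal z a∈z z⊑x b b∈x) (⊥L , ⊥L∉ₚ x , x≤x∨y)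

      compact⇒min-σ⊆Y : ∀ {a} → IsCompact L a → ∀ x → Min L (σ L a) x → Y L x
      compact⇒min-σ⊆Y a-compact x x-min S ⋁S∈x
        with min-σ-cover x x-min ⋁S∈x
      ... | e , e∉x , a≤⋁S∨e
        with a-compact (λ s → S s ⊎ s ≡ e)
                       (≤-trans a≤⋁S∨e (∨-least (⋁-mono λ _ → inj₁) (⋁-upper _ e (inj₂ refl))))
      ... | ts , ts⊆S∪e , a≤⋁ts
        with ⋁-list-∈ₚ x ts (∈ₚ-up x a≤⋁ts (proj₁ x-min))
      ... | t , t∈ts , t∈x
        with All.lookup ts⊆S∪e t∈ts
      ... | inj₁ St = t , St , t∈x
      ... | inj₂ refl = ⊥-elim (e∉x t∈x)

      min-σ⊆Y⇒compact : ∀ {a} → (∀ x → Min L (σ L a) x → Y L x) → IsCompact L a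
      min-σ⊆Y⇒compact min⊆Y S a≤⋁S = stable λ a∉J →
        let (z , a∈z , z∩J≡∅) = prime-filter-theorem (BelowFiniteJoin-isIdeal S) a∉J
            (m , m⊑z , m-min) = minimal-below z a∈z
            (s , Ss , s∈m) = min⊆Y m m-min S (∈ₚ-up m a≤⋁S (proj₁ m-min))
        in z∩J≡∅ s (m⊑z s s∈m) (s ∷ [] , Ss ∷ [] , ⋁-upper _ s (here refl))

      compact⇔σ-isSUpset : ∀ a → IsCompact L a ⇔ IsSUpset L (σ L a)
      compact⇔σ-isSUpset a = mk⇔
        (λ a-compact → σ-isClosed a , σ-isUpset a , compact⇒min-σ⊆Y a-compact)
        (λ (_ , _ , min⊆Y) → min-σ⊆Y⇒compact min⊆Y)

      compactFrame⇔min-X⊆Y : IsCompactFrame L ⇔ (∀ x → Min L (λ _ → ⊤) x → Y L x)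
      compactFrame⇔min-X⊆Y = mk⇔
        (λ ⊤L-compact x → compact⇒min-σ⊆Y ⊤L-compact x ∘ Min-cong X⇔σ⊤L x)
        (λ min⊆Y → min-σ⊆Y⇒compact λ x → min⊆Y x ∘ Min-cong (⇔-sym ∘ X⇔σ⊤L) x)
        where
        X⇔σ⊤L : ∀ x → ⊤ ⇔ σ L ⊤L x
        X⇔σ⊤L x = mk⇔ (λ _ → ⊤L∈ₚ x) (λ _ → tt)

corollary5p4 : LEM → Zorn → ∀ {c : Level} (L : Frame c) →
    (∀ (a : Frame.Carrier L) → IsCompact L a ⇔ IsSUpset L (σ L a))
    × (IsCompactFrame L ⇔ (∀ x → Min L (λ _ → ⊤) x → Y L x))
corollary5p4 lem zorn L = compact⇔σ-isSUpset L lem zorn , compactFrame⇔min-X⊆Y L lem zorn
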